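{- Let $c$ be a constant with $0<c<\frac{1}{2200}$ and let $D$ be an oriented graph on $n$ vertices with $\delta^0(D)\ge (1/2-c)n$. For every $U\subseteq V(D)$, with $\bar U=V(D)\setminus U$: (i) both $e^+(U,\bar U)$ and $e^-(U,\bar U)$ lie in the interval $\left[\frac{|U||\bar U|}{2}-c|U|n,\ \frac{|U||\bar U|}{2}+c|U|n\right]$; (ii) $e(U)\ge \frac{|U|(|U|-2cn)}{2}$; (iii) if $S\subseteq V(D)$ (not necessarily disjoint from $U$) satisfies $|S|,|U|\ge (1/2-c)n$, then there are at least $n^2/41$ arcs from $S$ to $U$.
   Context: $\delta^0(D)$ is the minimum over all vertices of out-degree and in-degree. For vertex sets $R,S$, $e^+(R,S)$ is the number of arcs from $R$ to $S$ and $e^-(R,S)$ the number of arcs from $S$ to $R$; $e(U)$ is the number of arcs of the subdigraph $D[U]$ induced by $U$.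
   Formalization: The constant c with $0<c<\frac{1}{2200}$ is taken to be rational. -}

module Defs where

open import Data.Nat using (ℕ; zero; suc)
open import Data.Bool using (Bool; true; false; _∧_; if_then_else_)
open import Data.Fin using (Fin)
open import Data.Fin.Subset using (Subset)
open import Data.Vec using (Vec; lookup; tabulate; sum)
open import Data.Integer using (+_)
open import Data.Rational using (ℚ; _/_)
open import Data.Product using (_×_)
open import Relation.Binary.PropositionalEquality using (_≡_)

Digraph : ℕ → Set
Digraph n = Fin n → Fin n → Bool

IsOriented : {n : ℕ} → Digraph n → Set
IsOriented {n} A =
  ((v : Fin n) → A v v ≡ false) × ((u v : Fin n) → A u v ≡ true → A v u ≡ false)

⟦_⟧ : Bool → ℕ
⟦ b ⟧ = if b then 1 else 0

count : {n : ℕ} → (Fin n → Bool) → ℕ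
count f = sum (tabulate (λ i → ⟦ f i ⟧))

outdeg : {n : ℕ} → Digraph n → Fin n → ℕ
outdeg A v = count (λ w → A v w)

indeg : {n : ℕ} → Digraph n → Fin n → ℕ
indeg A v = count (λ w → A w v)

e⁺ : {n : ℕ} → Digraph n → Subset n → Subset n → ℕ
e⁺ A R S = sum (tabulate (λ x → count (λ y → lookup R x ∧ lookup S y ∧ A x y)))

e⁻ : {n : ℕ} → Digraph n → Subset n → Subset n → ℕ
e⁻ A R S = e⁺ A S R

e : {n : ℕ} → Digraph n → Subset n → ℕ
e A U = e⁺ A U U

ℕ→ℚ : ℕ → ℚ
ℕ→ℚ k = + k / 1

{-# OPTIONS --safe #-}
-- Out-degrees give e(U) + e⁺(U,Ū) ≥ |U|(½ - c)n and in-degrees give e(U) + e⁻(U,Ū) ≥ |U|(½ - c)n,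
-- while orientation gives 2e(U) ≤ |U|² and e⁺(U,Ū) + e⁻(U,Ū) ≤ |U||Ū|. Since n = |U| + |Ū|,
-- suitable linear combinations of these four inequalities are (i) and (ii).
-- For (iii) let x = |S ∩ U| and s = |S ∖ U|, so that e⁺(S,U) ≥ e(S ∩ U) + e⁺(S ∖ U, U). The first
-- term is bounded by (ii). The second is at least the bound (i) for S ∖ U minus the at most
-- s·|V ∖ (S ∪ U)| arcs from S ∖ U to V ∖ (S ∪ U); as |U| ≥ (½ - c)n this leaves s²/2 - 2cns.
-- The sum is at least t²/4 - 2cnt for t = x + s = |S| ≥ (½ - c)n, which exceeds n²/41 once c ≤ 1/100.
module Submission where

open import Defs
open import Data.Nat using (ℕ)
open import Data.Fin using (Fin; zero; suc)
open import Data.Fin.Subset using (Subset; ∁; ∣_∣; ⊤; _∩_; _∪_)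
open import Data.Product using (_×_; _,_; proj₁; proj₂)
open import Data.Bool using (Bool; true; false; not; _∧_; _∨_)
open import Data.Vec using (lookup)
open import Function using (_∘_)
open import Relation.Binary.PropositionalEquality

module ArcCounting where
  open import Data.Nat
  open import Data.Nat.Properties
  open import Data.Vec as Vec using ([]; _∷_; tabulate)
  open import Data.Vec.Properties using (lookup-map; lookup-zipWith; lookup-replicate)
  open import Data.Fin.Subset.Properties using (∣⊤∣≡n)
  open import Algebra.Properties.Semiring.Sum +-*-semiring
    using (sum; sum-syntax; sum-cong-≗; ∑-distrib-+; ∑-comm; *-distribˡ-sum; *-distribʳ-sum)

  private
    variable
      n : ℕ
      D : Digraph n
      T U V W : Subset n

  -- outdeg (transpose D) v reduces to indeg D v, so in-degree facts are out-degree facts about transpose D.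
  transpose : Digraph n → Digraph n
  transpose D x y = D y x

  transpose-oriented : IsOriented D → IsOriented (transpose D)
  transpose-oriented (irreflexive , antisymmetric) = irreflexive , λ u v → antisymmetric v u

  χ : Subset n → Fin n → ℕ
  χ U i = ⟦ lookup U i ⟧

  record IsDisjointUnion (U V W : Subset n) : Set where
    constructor indicator-+
    field
      indicator-≡ : ∀ i → χ W i ≡ χ U i + χ V i

  ∁-split : (U : Subset n) → IsDisjointUnion U (∁ U) ⊤
  ∁-split U = indicator-+ λ i → begin
    χ ⊤ i                          ≡⟨ cong ⟦_⟧ (lookup-replicate i true) ⟩
    1                              ≡⟨ split (lookup U i) ⟩
    χ U i + ⟦ not (lookup U i) ⟧   ≡⟨ cong (λ b → χ U i + ⟦ b ⟧) (lookup-map i not U) ⟨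
    χ U i + χ (∁ U) i              ∎
    where
    open ≡-Reasoning
    split : ∀ u → 1 ≡ ⟦ u ⟧ + ⟦ not u ⟧
    split true  = refl
    split false = refl

  lookup-∩ : (S U : Subset n) (i : Fin n) → lookup (S ∩ U) i ≡ lookup S i ∧ lookup U i
  lookup-∩ S U i = lookup-zipWith _∧_ i S U

  lookup-∩∁ : (S U : Subset n) (i : Fin n) → lookup (S ∩ ∁ U) i ≡ lookup S i ∧ not (lookup U i)
  lookup-∩∁ S U i = trans (lookup-∩ S (∁ U) i) (cong (lookup S i ∧_) (lookup-map i not U))

  ∩-split : (S U : Subset n) → IsDisjointUnion (S ∩ U) (S ∩ ∁ U) S
  ∩-split S U = indicator-+ λ i →
    subst₂ (λ a b → χ S i ≡ ⟦ a ⟧ + ⟦ b ⟧) (sym (lookup-∩ S U i)) (sym (lookup-∩∁ S U i))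
      (split (lookup S i) (lookup U i))
    where
    split : ∀ s u → ⟦ s ⟧ ≡ ⟦ s ∧ u ⟧ + ⟦ s ∧ not u ⟧
    split false u     = refl
    split true  true  = refl
    split true  false = refl

  ∁-∪-split : (U V : Subset n) → (∀ i → lookup U i ∧ lookup V i ≡ false) →
              IsDisjointUnion V (∁ (U ∪ V)) (∁ U)
  ∁-∪-split U V disjoint = indicator-+ λ i →
    subst₂ (λ a b → ⟦ a ⟧ ≡ χ V i + ⟦ b ⟧) (sym (lookup-map i not U)) (sym (lookup-∁∪ i))
      (split (lookup U i) (lookup V i) (disjoint i))
    where
    lookup-∁∪ : ∀ i → lookup (∁ (U ∪ V)) i ≡ not (lookup U i ∨ lookup V i)
    lookup-∁∪ i = trans (lookup-map i not (U ∪ V)) (cong not (lookup-zipWith _∨_ i U V))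
    split : ∀ u v → u ∧ v ≡ false → ⟦ not u ⟧ ≡ ⟦ v ⟧ + ⟦ not (u ∨ v) ⟧
    split true  false _ = refl
    split false true  _ = refl
    split false false _ = refl

  sum-tabulate : (f : Fin n → ℕ) → Vec.sum (tabulate f) ≡ ∑[ i < n ] f i
  sum-tabulate {zero}  f = refl
  sum-tabulate {suc n} f = cong (f zero +_) (sum-tabulate (f ∘ suc))

  count≡∑ : (P : Fin n → Bool) → count P ≡ ∑[ i < n ] ⟦ P i ⟧
  count≡∑ P = sum-tabulate (λ i → ⟦ P i ⟧)

  ∣p∣≡∑ : (U : Subset n) → ∣ U ∣ ≡ ∑[ i < n ] χ U i
  ∣p∣≡∑ []          = refl
  ∣p∣≡∑ (true ∷ U)  = cong suc (∣p∣≡∑ U)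
  ∣p∣≡∑ (false ∷ U) = ∣p∣≡∑ U

  ∣∣-⊎ : IsDisjointUnion U V W → ∣ W ∣ ≡ ∣ U ∣ + ∣ V ∣
  ∣∣-⊎ {U = U} {V = V} {W = W} (indicator-+ split) = begin
    ∣ W ∣                       ≡⟨ ∣p∣≡∑ W ⟩
    sum (χ W)                   ≡⟨ sum-cong-≗ split ⟩
    sum (λ i → χ U i + χ V i)   ≡⟨ ∑-distrib-+ (χ U) (χ V) ⟩
    sum (χ U) + sum (χ V)       ≡⟨ cong₂ _+_ (∣p∣≡∑ U) (∣p∣≡∑ V) ⟨
    ∣ U ∣ + ∣ V ∣               ∎
    where open ≡-Reasoning

  ∣p∣+∣∁p∣≡n : (U : Subset n) → ∣ U ∣ + ∣ ∁ U ∣ ≡ n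
  ∣p∣+∣∁p∣≡n {n} U = trans (sym (∣∣-⊎ (∁-split U))) (∣⊤∣≡n n)

  ⟦∧⟧ : ∀ a b → ⟦ a ∧ b ⟧ ≡ ⟦ a ⟧ * ⟦ b ⟧
  ⟦∧⟧ false b = refl
  ⟦∧⟧ true  b = sym (+-identityʳ ⟦ b ⟧)

  ⟦⟧≤1 : ∀ a → ⟦ a ⟧ ≤ 1
  ⟦⟧≤1 false = z≤n
  ⟦⟧≤1 true  = ≤-refl

  *≤1⇒≤ : ∀ a {b} → b ≤ 1 → a * b ≤ a
  *≤1⇒≤ a {b} b≤1 = ≤-trans (*-monoʳ-≤ a b≤1) (≤-reflexive (*-identityʳ a))

  oriented-⟦⟧ : IsOriented D → ∀ x y → ⟦ D x y ⟧ + ⟦ D y x ⟧ ≤ 1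
  oriented-⟦⟧ {D = D} (_ , antisymmetric) x y with D x y in xy
  ... | true  rewrite antisymmetric x y xy = ≤-refl
  ... | false = ⟦⟧≤1 (D y x)

  ∑∑ : (Fin n → Fin n → ℕ) → ℕ
  ∑∑ {n} f = ∑[ x < n ] ∑[ y < n ] f x y

  ∑∑-cong : {f g : Fin n → Fin n → ℕ} → (∀ x y → f x y ≡ g x y) → ∑∑ f ≡ ∑∑ g
  ∑∑-cong {f = f} {g} f≡g = sum-cong-≗ {x = λ x → sum (f x)} (λ x → sum-cong-≗ {x = f x} {g x} (f≡g x))

  ∑∑-distrib-+ : (f g : Fin n → Fin n → ℕ) → ∑∑ (λ x y → f x y + g x y) ≡ ∑∑ f + ∑∑ g
  ∑∑-distrib-+ f g =
    trans (sum-cong-≗ {x = λ x → sum (λ y → f x y + g x y)} (λ x → ∑-distrib-+ (f x) (g x)))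
          (∑-distrib-+ (λ x → sum (f x)) (λ x → sum (g x)))

  ∑-mono-≤ : {f g : Fin n → ℕ} → (∀ x → f x ≤ g x) → sum f ≤ sum g
  ∑-mono-≤ {zero}  f≤g = z≤n
  ∑-mono-≤ {suc n} f≤g = +-mono-≤ (f≤g zero) (∑-mono-≤ (f≤g ∘ suc))

  ∑∑-mono-≤ : {f g : Fin n → Fin n → ℕ} → (∀ x y → f x y ≤ g x y) → ∑∑ f ≤ ∑∑ g
  ∑∑-mono-≤ f≤g = ∑-mono-≤ (λ x → ∑-mono-≤ (f≤g x))

  ∑∑-product : (U V : Subset n) → ∑∑ (λ x y → χ U x * χ V y) ≡ ∣ U ∣ * ∣ V ∣
  ∑∑-product {n} U V = begin
    ∑[ x < n ] ∑[ y < n ] (χ U x * χ V y)   ≡⟨ sum-cong-≗ (λ x → *-distribˡ-sum (χ U x) (χ V)) ⟨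
    ∑[ x < n ] (χ U x * ∑[ y < n ] χ V y)   ≡⟨ *-distribʳ-sum (∑[ y < n ] χ V y) (χ U) ⟨
    ∑[ x < n ] χ U x * ∑[ y < n ] χ V y     ≡⟨ cong₂ _*_ (∣p∣≡∑ U) (∣p∣≡∑ V) ⟨
    ∣ U ∣ * ∣ V ∣                           ∎
    where open ≡-Reasoning

  e⁺≡∑∑ : (D : Digraph n) (U V : Subset n) → e⁺ D U V ≡ ∑∑ (λ x y → χ U x * χ V y * ⟦ D x y ⟧)
  e⁺≡∑∑ D U V =
    trans (sum-tabulate (λ x → count (λ y → lookup U x ∧ lookup V y ∧ D x y)))
          (sum-cong-≗ (λ x → trans (count≡∑ (λ y → lookup U x ∧ lookup V y ∧ D x y))
                                   (sum-cong-≗ (indicator x))))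
    where
    indicator : ∀ x y → ⟦ lookup U x ∧ lookup V y ∧ D x y ⟧ ≡ χ U x * χ V y * ⟦ D x y ⟧
    indicator x y = begin
      ⟦ lookup U x ∧ lookup V y ∧ D x y ⟧   ≡⟨ ⟦∧⟧ (lookup U x) _ ⟩
      χ U x * ⟦ lookup V y ∧ D x y ⟧        ≡⟨ cong (χ U x *_) (⟦∧⟧ (lookup V y) (D x y)) ⟩
      χ U x * (χ V y * ⟦ D x y ⟧)           ≡⟨ *-assoc (χ U x) _ _ ⟨
      χ U x * χ V y * ⟦ D x y ⟧             ∎
      where open ≡-Reasoning

  e⁺-⊎ʳ : IsDisjointUnion V W T → e⁺ D U T ≡ e⁺ D U V + e⁺ D U W
  e⁺-⊎ʳ {V = V} {W = W} {T = T} {D = D} {U = U} (indicator-+ split) = begin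
    e⁺ D U T
      ≡⟨ e⁺≡∑∑ D U T ⟩
    ∑∑ (λ x y → χ U x * χ T y * ⟦ D x y ⟧)
      ≡⟨ ∑∑-cong split-at ⟩
    ∑∑ (λ x y → χ U x * χ V y * ⟦ D x y ⟧ + χ U x * χ W y * ⟦ D x y ⟧)
      ≡⟨ ∑∑-distrib-+ (λ x y → χ U x * χ V y * ⟦ D x y ⟧) _ ⟩
    ∑∑ (λ x y → χ U x * χ V y * ⟦ D x y ⟧) + ∑∑ (λ x y → χ U x * χ W y * ⟦ D x y ⟧)
      ≡⟨ cong₂ _+_ (e⁺≡∑∑ D U V) (e⁺≡∑∑ D U W) ⟨
    e⁺ D U V + e⁺ D U W
      ∎
    where
    open ≡-Reasoning
    split-at : ∀ x y → χ U x * χ T y * ⟦ D x y ⟧ ≡ χ U x * χ V y * ⟦ D x y ⟧ + χ U x * χ W y * ⟦ D x y ⟧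
    split-at x y rewrite split y | *-distribˡ-+ (χ U x) (χ V y) (χ W y) =
      *-distribʳ-+ ⟦ D x y ⟧ (χ U x * χ V y) _

  e⁺-transpose : (D : Digraph n) (U V : Subset n) → e⁺ D U V ≡ e⁺ (transpose D) V U
  e⁺-transpose D U V = begin
    e⁺ D U V
      ≡⟨ e⁺≡∑∑ D U V ⟩
    ∑∑ (λ x y → χ U x * χ V y * ⟦ D x y ⟧)
      ≡⟨ ∑-comm (λ x y → χ U x * χ V y * ⟦ D x y ⟧) ⟩
    ∑∑ (λ y x → χ U x * χ V y * ⟦ D x y ⟧)
      ≡⟨ ∑∑-cong (λ y x → cong (_* ⟦ D x y ⟧) (*-comm (χ U x) (χ V y))) ⟩
    ∑∑ (λ y x → χ V y * χ U x * ⟦ D x y ⟧)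
      ≡⟨ e⁺≡∑∑ (transpose D) V U ⟨
    e⁺ (transpose D) V U
      ∎
    where open ≡-Reasoning

  e⁺-⊎ˡ : IsDisjointUnion U V T → e⁺ D T W ≡ e⁺ D U W + e⁺ D V W
  e⁺-⊎ˡ {U = U} {V = V} {T = T} {D = D} {W = W} UV = begin
    e⁺ D T W                                      ≡⟨ e⁺-transpose D T W ⟩
    e⁺ (transpose D) W T                          ≡⟨ e⁺-⊎ʳ {D = transpose D} {U = W} UV ⟩
    e⁺ (transpose D) W U + e⁺ (transpose D) W V   ≡⟨ cong₂ _+_ (e⁺-transpose D U W) (e⁺-transpose D V W) ⟨
    e⁺ D U W + e⁺ D V W                           ∎
    where open ≡-Reasoning

  e⁺-monoʳ : (∀ i → χ V i ≤ χ W i) → e⁺ D U V ≤ e⁺ D U W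
  e⁺-monoʳ {V = V} {W = W} {D = D} {U = U} V⊆W = begin
    e⁺ D U V
      ≡⟨ e⁺≡∑∑ D U V ⟩
    ∑∑ (λ x y → χ U x * χ V y * ⟦ D x y ⟧)
      ≤⟨ ∑∑-mono-≤ (λ x y → *-monoˡ-≤ ⟦ D x y ⟧ (*-monoʳ-≤ (χ U x) (V⊆W y))) ⟩
    ∑∑ (λ x y → χ U x * χ W y * ⟦ D x y ⟧)
      ≡⟨ e⁺≡∑∑ D U W ⟨
    e⁺ D U W
      ∎
    where open ≤-Reasoning

  e⁺≤∣∣*∣∣ : (D : Digraph n) (U V : Subset n) → e⁺ D U V ≤ ∣ U ∣ * ∣ V ∣
  e⁺≤∣∣*∣∣ D U V = begin
    e⁺ D U V
      ≡⟨ e⁺≡∑∑ D U V ⟩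
    ∑∑ (λ x y → χ U x * χ V y * ⟦ D x y ⟧)
      ≤⟨ ∑∑-mono-≤ (λ x y → *≤1⇒≤ (χ U x * χ V y) (⟦⟧≤1 (D x y))) ⟩
    ∑∑ (λ x y → χ U x * χ V y)
      ≡⟨ ∑∑-product U V ⟩
    ∣ U ∣ * ∣ V ∣
      ∎
    where open ≤-Reasoning

  e⁺+e⁻≤∣∣*∣∣ : (D : Digraph n) (U V : Subset n) → IsOriented D → e⁺ D U V + e⁻ D U V ≤ ∣ U ∣ * ∣ V ∣
  e⁺+e⁻≤∣∣*∣∣ D U V oriented = begin
    e⁺ D U V + e⁻ D U V
      ≡⟨ cong₂ _+_ (e⁺≡∑∑ D U V) (trans (e⁺-transpose D V U) (e⁺≡∑∑ (transpose D) U V)) ⟩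
    ∑∑ (λ x y → χ U x * χ V y * ⟦ D x y ⟧) + ∑∑ (λ x y → χ U x * χ V y * ⟦ D y x ⟧)
      ≡⟨ ∑∑-distrib-+ (λ x y → χ U x * χ V y * ⟦ D x y ⟧) _ ⟨
    ∑∑ (λ x y → χ U x * χ V y * ⟦ D x y ⟧ + χ U x * χ V y * ⟦ D y x ⟧)
      ≡⟨ ∑∑-cong (λ x y → *-distribˡ-+ (χ U x * χ V y) ⟦ D x y ⟧ ⟦ D y x ⟧) ⟨
    ∑∑ (λ x y → χ U x * χ V y * (⟦ D x y ⟧ + ⟦ D y x ⟧))
      ≤⟨ ∑∑-mono-≤ (λ x y → *≤1⇒≤ (χ U x * χ V y) (oriented-⟦⟧ oriented x y)) ⟩
    ∑∑ (λ x y → χ U x * χ V y)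
      ≡⟨ ∑∑-product U V ⟩
    ∣ U ∣ * ∣ V ∣
      ∎
    where open ≤-Reasoning

  e⁺-⊤≡∑outdeg : (D : Digraph n) (U : Subset n) → e⁺ D U ⊤ ≡ ∑[ x < n ] (χ U x * outdeg D x)
  e⁺-⊤≡∑outdeg {n} D U = begin
    e⁺ D U ⊤
      ≡⟨ e⁺≡∑∑ D U ⊤ ⟩
    ∑∑ (λ x y → χ U x * χ ⊤ y * ⟦ D x y ⟧)
      ≡⟨ ∑∑-cong drop-⊤ ⟩
    ∑[ x < n ] ∑[ y < n ] (χ U x * ⟦ D x y ⟧)
      ≡⟨ sum-cong-≗ (λ x → *-distribˡ-sum (χ U x) (λ y → ⟦ D x y ⟧)) ⟨
    ∑[ x < n ] (χ U x * ∑[ y < n ] ⟦ D x y ⟧)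
      ≡⟨ sum-cong-≗ (λ x → cong (χ U x *_) (count≡∑ (D x))) ⟨
    ∑[ x < n ] (χ U x * outdeg D x)
      ∎
    where
    open ≡-Reasoning
    drop-⊤ : ∀ x y → χ U x * χ ⊤ y * ⟦ D x y ⟧ ≡ χ U x * ⟦ D x y ⟧
    drop-⊤ x y rewrite lookup-replicate {n = n} y true = cong (_* ⟦ D x y ⟧) (*-identityʳ (χ U x))

open ArcCounting

open import Data.Nat as ℕ using (NonZero)
import Data.Nat.Properties as ℕ
open import Data.Nat.Coprimality as Coprimality using (1-coprimeTo)
open import Data.Integer as ℤ using (+_)
import Data.Integer.Properties as ℤ
open import Data.Rational using (ℚ; mkℚ; _/_; _+_; _-_; _*_; -_; _≤_; _<_; 0ℚ; ½; nonNegative)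
open import Data.Rational.Properties
open import Data.Rational.Solver using (module +-*-Solver)
open +-*-Solver using (solve; _:=_; _:+_; _:-_; _:*_; :-_; con)
open import Data.Sum using (inj₁; inj₂)
open import Relation.Nullary.Decidable using (toWitness)
open import Algebra.Properties.Semiring.Sum ℕ.+-*-semiring using (sum-syntax)

ℕ→ℚ≡mkℚ : ∀ k → ℕ→ℚ k ≡ mkℚ (+ k) 0 (Coprimality.sym (1-coprimeTo k))
ℕ→ℚ≡mkℚ k = normalize-coprime (Coprimality.sym (1-coprimeTo k))

ℕ→ℚ-+ : ∀ a b → ℕ→ℚ (a ℕ.+ b) ≡ ℕ→ℚ a + ℕ→ℚ b
ℕ→ℚ-+ a b = begin
  + (a ℕ.+ b) / 1                     ≡⟨ cong (_/ 1) (ℤ.pos-+ a b) ⟩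
  (+ a ℤ.+ + b) / 1                   ≡⟨ cong (_/ 1) (cong₂ ℤ._+_ (ℤ.*-identityʳ (+ a)) (ℤ.*-identityʳ (+ b))) ⟨
  (+ a ℤ.* + 1 ℤ.+ + b ℤ.* + 1) / 1   ≡⟨ cong₂ _+_ (ℕ→ℚ≡mkℚ a) (ℕ→ℚ≡mkℚ b) ⟨
  ℕ→ℚ a + ℕ→ℚ b                       ∎
  where open ≡-Reasoning

ℕ→ℚ-* : ∀ a b → ℕ→ℚ (a ℕ.* b) ≡ ℕ→ℚ a * ℕ→ℚ b
ℕ→ℚ-* a b = begin
  + (a ℕ.* b) / 1     ≡⟨ cong (_/ 1) (ℤ.pos-* a b) ⟩
  (+ a ℤ.* + b) / 1   ≡⟨ cong₂ _*_ (ℕ→ℚ≡mkℚ a) (ℕ→ℚ≡mkℚ b) ⟨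
  ℕ→ℚ a * ℕ→ℚ b       ∎
  where open ≡-Reasoning

0≤+k/d : ∀ k d .{{_ : NonZero d}} → 0ℚ ≤ + k / d
0≤+k/d k d = nonNegative⁻¹ (+ k / d) {{normalize-nonNeg k d}}

0≤ℕ→ℚ : ∀ k → 0ℚ ≤ ℕ→ℚ k
0≤ℕ→ℚ k = 0≤+k/d k 1

0≤p+q : ∀ {p q} → 0ℚ ≤ p → 0ℚ ≤ q → 0ℚ ≤ p + q
0≤p+q = +-mono-≤

0≤p*q : ∀ {p q} → 0ℚ ≤ p → 0ℚ ≤ q → 0ℚ ≤ p * q
0≤p*q {p} {q} 0≤p 0≤q =
  nonNegative⁻¹ (p * q) {{nonNeg*nonNeg⇒nonNeg p {{nonNegative 0≤p}} q {{nonNegative 0≤q}}}}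

0≤p*p : ∀ p → 0ℚ ≤ p * p
0≤p*p p with ≤-total 0ℚ p
... | inj₁ 0≤p = 0≤p*q 0≤p 0≤p
... | inj₂ p≤0 = subst (0ℚ ≤_) (solve 1 (λ p → (:- p) :* (:- p) := p :* p) refl p) (0≤p*q 0≤-p 0≤-p)
  where
  0≤-p : 0ℚ ≤ - p
  0≤-p = neg-antimono-≤ p≤0

p≤q⇒0≤q-p : ∀ {p q} → p ≤ q → 0ℚ ≤ q - p
p≤q⇒0≤q-p {p} {q} p≤q = subst (_≤ q - p) (+-inverseʳ p) (+-monoˡ-≤ (- p) p≤q)

0≤q-p⇒p≤q : ∀ {p q} → 0ℚ ≤ q - p → p ≤ q
0≤q-p⇒p≤q {p} {q} 0≤q-p =
  subst₂ _≤_ (+-identityʳ p) (solve 2 (λ p q → p :+ (q :- p) := q) refl p q) (+-monoʳ-≤ p 0≤q-p)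

q-p≡r⇒p≤q : ∀ {p q r} → 0ℚ ≤ r → q - p ≡ r → p ≤ q
q-p≡r⇒p≤q 0≤r q-p≡r = 0≤q-p⇒p≤q (subst (0ℚ ≤_) (sym q-p≡r) 0≤r)

ℕ→ℚ-mono-≤ : ∀ {a b} → a ℕ.≤ b → ℕ→ℚ a ≤ ℕ→ℚ b
ℕ→ℚ-mono-≤ {a} {b} a≤b = begin
  ℕ→ℚ a                   ≡⟨ +-identityʳ (ℕ→ℚ a) ⟨
  ℕ→ℚ a + 0ℚ              ≤⟨ +-monoʳ-≤ (ℕ→ℚ a) (0≤ℕ→ℚ (b ℕ.∸ a)) ⟩
  ℕ→ℚ a + ℕ→ℚ (b ℕ.∸ a)   ≡⟨ ℕ→ℚ-+ a (b ℕ.∸ a) ⟨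
  ℕ→ℚ (a ℕ.+ (b ℕ.∸ a))   ≡⟨ cong ℕ→ℚ (ℕ.m+[n∸m]≡n a≤b) ⟩
  ℕ→ℚ b                   ∎
  where open ≤-Reasoning

∑f*δ≤∑f*g : ∀ {n} (f g : Fin n → ℕ) {δ} → (∀ x → δ ≤ ℕ→ℚ (g x)) →
            ℕ→ℚ (∑[ x < n ] f x) * δ ≤ ℕ→ℚ (∑[ x < n ] (f x ℕ.* g x))
∑f*δ≤∑f*g {ℕ.zero}  f g {δ} δ≤g = ≤-reflexive (*-zeroˡ δ)
∑f*δ≤∑f*g {ℕ.suc n} f g {δ} δ≤g = begin
  ℕ→ℚ (f₀ ℕ.+ F) * δ          ≡⟨ cong (_* δ) (ℕ→ℚ-+ f₀ F) ⟩
  (ℕ→ℚ f₀ + ℕ→ℚ F) * δ        ≡⟨ *-distribʳ-+ δ (ℕ→ℚ f₀) (ℕ→ℚ F) ⟩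
  ℕ→ℚ f₀ * δ + ℕ→ℚ F * δ      ≤⟨ +-mono-≤ (*-monoˡ-≤-nonNeg (ℕ→ℚ f₀) {{nonNegative (0≤ℕ→ℚ f₀)}} (δ≤g zero))
                                          (∑f*δ≤∑f*g (f ∘ suc) (g ∘ suc) (δ≤g ∘ suc)) ⟩
  ℕ→ℚ f₀ * ℕ→ℚ g₀ + ℕ→ℚ FG    ≡⟨ cong (_+ ℕ→ℚ FG) (ℕ→ℚ-* f₀ g₀) ⟨
  ℕ→ℚ (f₀ ℕ.* g₀) + ℕ→ℚ FG    ≡⟨ ℕ→ℚ-+ (f₀ ℕ.* g₀) FG ⟨
  ℕ→ℚ (f₀ ℕ.* g₀ ℕ.+ FG)      ∎
  where
  open ≤-Reasoning
  f₀ g₀ F FG : ℕ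
  f₀ = f zero
  g₀ = g zero
  F  = ∑[ x < n ] f (suc x)
  FG = ∑[ x < n ] (f (suc x) ℕ.* g (suc x))

cut-lower-bound : ∀ u ū A B c N → N ≡ u + ū →
  u * ((½ - c) * N) ≤ A + B → A + A ≤ u * u → u * ū * ½ - c * u * N ≤ B
cut-lower-bound u ū A B c _ refl out-arcs inside = q-p≡r⇒p≤q
  (0≤p+q (p≤q⇒0≤q-p out-arcs) (0≤p*q (0≤+k/d 1 2) (p≤q⇒0≤q-p inside)))
  (solve 5 (λ u ū A B c →
      B :- (u :* ū :* con ½ :- c :* u :* (u :+ ū))
    := (A :+ B :- u :* ((con ½ :- c) :* (u :+ ū))) :+ con ½ :* (u :* u :- (A :+ A)))
    refl u ū A B c)

cut-upper-bound : ∀ p k B C → B + C ≤ p → p * ½ - k ≤ C → B ≤ p * ½ + k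
cut-upper-bound p k B C both-ways reverse = q-p≡r⇒p≤q
  (0≤p+q (p≤q⇒0≤q-p both-ways) (p≤q⇒0≤q-p reverse))
  (solve 4 (λ p k B C → p :* con ½ :+ k :- B := (p :- (B :+ C)) :+ (C :- (p :* con ½ :- k))) refl p k B C)

inside-lower-bound : ∀ u ū A B C c N → N ≡ u + ū →
  u * ((½ - c) * N) ≤ A + B → u * ((½ - c) * N) ≤ A + C → B + C ≤ u * ū →
  u * (u - + 2 / 1 * c * N) * ½ ≤ A
inside-lower-bound u ū A B C c _ refl out-arcs in-arcs both-ways = q-p≡r⇒p≤q
  (0≤p*q (0≤+k/d 1 2) (0≤p+q (0≤p+q (p≤q⇒0≤q-p out-arcs) (p≤q⇒0≤q-p in-arcs)) (p≤q⇒0≤q-p both-ways)))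
  (solve 6 (λ u ū A B C c →
      A :- u :* (u :- con (+ 2 / 1) :* c :* (u :+ ū)) :* con ½
    := con ½ :* ((A :+ B :- u :* ((con ½ :- c) :* (u :+ ū)))
                 :+ (A :+ C :- u :* ((con ½ :- c) :* (u :+ ū)))
                 :+ (u :* ū :- (B :+ C))))
    refl u ū A B C c)

into-large-lower-bound : ∀ s q r w B W c N → N ≡ s + q → q ≡ r + w →
  s * q * ½ - c * s * N ≤ B + W → W ≤ s * w → (½ - c) * N ≤ r → 0ℚ ≤ s →
  s * (s * ½ - + 2 / 1 * c * N) ≤ B
into-large-lower-bound s _ r w B W c _ refl refl out-arcs avoided large 0≤s = q-p≡r⇒p≤q
  (0≤p+q (0≤p+q (p≤q⇒0≤q-p out-arcs) (p≤q⇒0≤q-p avoided)) (0≤p*q 0≤s (p≤q⇒0≤q-p large)))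
  (solve 6 (λ s r w B W c →
      B :- s :* (s :* con ½ :- con (+ 2 / 1) :* c :* (s :+ (r :+ w)))
    := (B :+ W :- (s :* (r :+ w) :* con ½ :- c :* s :* (s :+ (r :+ w))))
       :+ (s :* w :- W)
       :+ s :* (r :- (con ½ :- c) :* (s :+ (r :+ w))))
    refl s r w B W c)

halves-≥-quarter : ∀ x s c N → 0ℚ ≤ x → 0ℚ ≤ c → 0ℚ ≤ N →
  (x + s) * (x + s) * (+ 1 / 4) - + 2 / 1 * c * N * (x + s) ≤
  x * (x - + 2 / 1 * c * N) * ½ + s * (s * ½ - + 2 / 1 * c * N)
halves-≥-quarter x s c N 0≤x 0≤c 0≤N = q-p≡r⇒p≤q
  (0≤p+q (0≤p*q (0≤+k/d 1 4) (0≤p*p (x - s))) (0≤p*q (0≤p*q 0≤c 0≤N) 0≤x))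
  (solve 4 (λ x s c N →
      x :* (x :- con (+ 2 / 1) :* c :* N) :* con ½ :+ s :* (s :* con ½ :- con (+ 2 / 1) :* c :* N)
        :- ((x :+ s) :* (x :+ s) :* con (+ 1 / 4) :- con (+ 2 / 1) :* c :* N :* (x :+ s))
    := con (+ 1 / 4) :* ((x :- s) :* (x :- s)) :+ c :* N :* x)
    refl x s c N)

-- t ↦ t²/4 - 2cNt increases for t ≥ 4cN, so it suffices to check t = (½ - c)N.
quarter-square-bound : ∀ c N t → 0ℚ ≤ c → c ≤ + 1 / 100 → 0ℚ ≤ N → (½ - c) * N ≤ t →
  N * N * (+ 1 / 41) ≤ t * t * (+ 1 / 4) - + 2 / 1 * c * N * t
quarter-square-bound c N t 0≤c c≤1/100 0≤N large = q-p≡r⇒p≤q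
  (0≤p+q (0≤p+q (0≤p*q (0≤+k/d 1 4) (0≤p*p (t - δ))) (0≤p*q (0≤p*q excess 0≤N) slope))
         (0≤p*q (0≤p*p N) constant))
  (solve 3 (λ c N t →
      t :* t :* con (+ 1 / 4) :- con (+ 2 / 1) :* c :* N :* t :- N :* N :* con (+ 1 / 41)
    := con (+ 1 / 4) :* ((t :- (con ½ :- c) :* N) :* (t :- (con ½ :- c) :* N))
       :+ (t :- (con ½ :- c) :* N) :* N :* (con (+ 5 / 2) :* (con (+ 1 / 100) :- c) :+ con (+ 9 / 40))
       :+ N :* N :* (con (+ 9 / 4) :* c :* c :+ con (+ 5 / 4) :* (con (+ 1 / 100) :- c) :+ con (+ 21 / 820)))
    refl c N t)
  where
  δ : ℚ
  δ = (½ - c) * N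
  excess : 0ℚ ≤ t - δ
  excess = p≤q⇒0≤q-p large
  margin : 0ℚ ≤ + 1 / 100 - c
  margin = p≤q⇒0≤q-p c≤1/100
  slope : 0ℚ ≤ + 5 / 2 * (+ 1 / 100 - c) + + 9 / 40
  slope = 0≤p+q (0≤p*q (0≤+k/d 5 2) margin) (0≤+k/d 9 40)
  constant : 0ℚ ≤ + 9 / 4 * c * c + + 5 / 4 * (+ 1 / 100 - c) + + 21 / 820
  constant = 0≤p+q (0≤p+q (0≤p*q (0≤p*q (0≤+k/d 9 4) 0≤c) 0≤c) (0≤p*q (0≤+k/d 5 4) margin)) (0≤+k/d 21 820)

MinOutdegree : ∀ {n} → Digraph n → ℚ → Set
MinOutdegree {n} D c = ∀ v → (½ - c) * ℕ→ℚ n ≤ ℕ→ℚ (outdeg D v)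

module _ {n : ℕ} where

  ℕ→ℚ-∣∣-⊎ : {U V W : Subset n} → IsDisjointUnion U V W → ℕ→ℚ ∣ W ∣ ≡ ℕ→ℚ ∣ U ∣ + ℕ→ℚ (∣ V ∣)
  ℕ→ℚ-∣∣-⊎ {U} {V} UV = trans (cong ℕ→ℚ (∣∣-⊎ UV)) (ℕ→ℚ-+ ∣ U ∣ ∣ V ∣)

  ℕ→ℚ-∣p∣+∣∁p∣ : (U : Subset n) → ℕ→ℚ n ≡ ℕ→ℚ ∣ U ∣ + ℕ→ℚ (∣ ∁ U ∣)
  ℕ→ℚ-∣p∣+∣∁p∣ U = trans (cong ℕ→ℚ (sym (∣p∣+∣∁p∣≡n U))) (ℕ→ℚ-+ ∣ U ∣ ∣ ∁ U ∣)

  ℕ→ℚ-e⁺-⊎ʳ : (D : Digraph n) (U : Subset n) {V W T : Subset n} → IsDisjointUnion V W T →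
              ℕ→ℚ (e⁺ D U T) ≡ ℕ→ℚ (e⁺ D U V) + ℕ→ℚ (e⁺ D U W)
  ℕ→ℚ-e⁺-⊎ʳ D U {V} {W} VW =
    trans (cong ℕ→ℚ (e⁺-⊎ʳ {D = D} {U = U} VW)) (ℕ→ℚ-+ (e⁺ D U V) (e⁺ D U W))

  ℕ→ℚ-e⁺≤∣∣*∣∣ : (D : Digraph n) (U V : Subset n) → ℕ→ℚ (e⁺ D U V) ≤ ℕ→ℚ ∣ U ∣ * ℕ→ℚ ∣ V ∣
  ℕ→ℚ-e⁺≤∣∣*∣∣ D U V =
    subst (ℕ→ℚ (e⁺ D U V) ≤_) (ℕ→ℚ-* ∣ U ∣ ∣ V ∣) (ℕ→ℚ-mono-≤ (e⁺≤∣∣*∣∣ D U V))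

  ℕ→ℚ-e⁺+e⁻≤∣∣*∣∣ : (D : Digraph n) (U V : Subset n) → IsOriented D →
                    ℕ→ℚ (e⁺ D U V) + ℕ→ℚ (e⁻ D U V) ≤ ℕ→ℚ (∣ U ∣ ℕ.* ∣ V ∣)
  ℕ→ℚ-e⁺+e⁻≤∣∣*∣∣ D U V oriented =
    subst (_≤ ℕ→ℚ (∣ U ∣ ℕ.* ∣ V ∣)) (ℕ→ℚ-+ (e⁺ D U V) (e⁻ D U V)) (ℕ→ℚ-mono-≤ (e⁺+e⁻≤∣∣*∣∣ D U V oriented))

module MinOutdegreeBounds {n : ℕ} (D : Digraph n) (c : ℚ)
                          (oriented : IsOriented D) (δ⁺ : MinOutdegree D c) where

  out-arcs-≥ : (U : Subset n) → ℕ→ℚ ∣ U ∣ * ((½ - c) * ℕ→ℚ n) ≤ ℕ→ℚ (e⁺ D U ⊤)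
  out-arcs-≥ U = begin
    ℕ→ℚ ∣ U ∣ * δ                                  ≡⟨ cong (λ k → ℕ→ℚ k * δ) (∣p∣≡∑ U) ⟩
    ℕ→ℚ (∑[ x < n ] χ U x) * δ                     ≤⟨ ∑f*δ≤∑f*g (χ U) (outdeg D) δ⁺ ⟩
    ℕ→ℚ (∑[ x < n ] (χ U x ℕ.* outdeg D x))        ≡⟨ cong ℕ→ℚ (e⁺-⊤≡∑outdeg D U) ⟨
    ℕ→ℚ (e⁺ D U ⊤)                                 ∎
    where
    open ≤-Reasoning
    δ : ℚ
    δ = (½ - c) * ℕ→ℚ n

  out-arcs-split-≥ : (U : Subset n) →
    ℕ→ℚ ∣ U ∣ * ((½ - c) * ℕ→ℚ n) ≤ ℕ→ℚ (e D U) + ℕ→ℚ (e⁺ D U (∁ U))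
  out-arcs-split-≥ U =
    subst (ℕ→ℚ ∣ U ∣ * ((½ - c) * ℕ→ℚ n) ≤_) (ℕ→ℚ-e⁺-⊎ʳ D U (∁-split U)) (out-arcs-≥ U)

  e⁺-∁-≥ : (U : Subset n) →
    ℕ→ℚ (∣ U ∣ ℕ.* ∣ ∁ U ∣) * ½ - c * ℕ→ℚ ∣ U ∣ * ℕ→ℚ n ≤ ℕ→ℚ (e⁺ D U (∁ U))
  e⁺-∁-≥ U =
    subst (λ p → p * ½ - c * ℕ→ℚ ∣ U ∣ * ℕ→ℚ n ≤ ℕ→ℚ (e⁺ D U (∁ U))) (sym (ℕ→ℚ-* ∣ U ∣ ∣ ∁ U ∣))
      (cut-lower-bound (ℕ→ℚ ∣ U ∣) (ℕ→ℚ ∣ ∁ U ∣) (ℕ→ℚ (e D U)) (ℕ→ℚ (e⁺ D U (∁ U))) c (ℕ→ℚ n)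
        (ℕ→ℚ-∣p∣+∣∁p∣ U) (out-arcs-split-≥ U) inside)
    where
    inside : ℕ→ℚ (e D U) + ℕ→ℚ (e D U) ≤ ℕ→ℚ ∣ U ∣ * ℕ→ℚ ∣ U ∣
    inside = subst (ℕ→ℚ (e D U) + ℕ→ℚ (e D U) ≤_) (ℕ→ℚ-* ∣ U ∣ ∣ U ∣) (ℕ→ℚ-e⁺+e⁻≤∣∣*∣∣ D U U oriented)

  e⁺-into-disjoint-≥ : (P R : Subset n) → (∀ i → lookup P i ∧ lookup R i ≡ false) →
    (½ - c) * ℕ→ℚ n ≤ ℕ→ℚ ∣ R ∣ →
    ℕ→ℚ ∣ P ∣ * (ℕ→ℚ ∣ P ∣ * ½ - + 2 / 1 * c * ℕ→ℚ n) ≤ ℕ→ℚ (e⁺ D P R)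
  e⁺-into-disjoint-≥ P R disjoint large =
    into-large-lower-bound (ℕ→ℚ ∣ P ∣) (ℕ→ℚ ∣ ∁ P ∣) (ℕ→ℚ ∣ R ∣) (ℕ→ℚ ∣ W ∣)
                           (ℕ→ℚ (e⁺ D P R)) (ℕ→ℚ (e⁺ D P W)) c (ℕ→ℚ n)
      (ℕ→ℚ-∣p∣+∣∁p∣ P) (ℕ→ℚ-∣∣-⊎ (∁-∪-split P R disjoint)) out-arcs
      (ℕ→ℚ-e⁺≤∣∣*∣∣ D P W) large (0≤ℕ→ℚ ∣ P ∣)
    where
    W : Subset n
    W = ∁ (P ∪ R)
    out-arcs : ℕ→ℚ ∣ P ∣ * ℕ→ℚ ∣ ∁ P ∣ * ½ - c * ℕ→ℚ ∣ P ∣ * ℕ→ℚ n ≤ ℕ→ℚ (e⁺ D P R) + ℕ→ℚ (e⁺ D P W)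
    out-arcs = subst₂ _≤_ (cong (λ p → p * ½ - c * ℕ→ℚ ∣ P ∣ * ℕ→ℚ n) (ℕ→ℚ-* ∣ P ∣ ∣ ∁ P ∣))
                          (ℕ→ℚ-e⁺-⊎ʳ D P (∁-∪-split P R disjoint)) (e⁺-∁-≥ P)

module SemidegreeBounds {n : ℕ} (D : Digraph n) (c : ℚ) (oriented : IsOriented D)
                        (δ⁺ : MinOutdegree D c) (δ⁻ : MinOutdegree (transpose D) c) where

  open MinOutdegreeBounds D c oriented δ⁺ public
  private
    module Dᵀ = MinOutdegreeBounds (transpose D) c (transpose-oriented oriented) δ⁻

  e⁻-∁-≥ : (U : Subset n) →
    ℕ→ℚ (∣ U ∣ ℕ.* ∣ ∁ U ∣) * ½ - c * ℕ→ℚ ∣ U ∣ * ℕ→ℚ n ≤ ℕ→ℚ (e⁻ D U (∁ U))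
  e⁻-∁-≥ U = subst (_ ≤_) (cong ℕ→ℚ (sym (e⁺-transpose D (∁ U) U))) (Dᵀ.e⁺-∁-≥ U)

  e⁺-∁-≤ : (U : Subset n) →
    ℕ→ℚ (e⁺ D U (∁ U)) ≤ ℕ→ℚ (∣ U ∣ ℕ.* ∣ ∁ U ∣) * ½ + c * ℕ→ℚ ∣ U ∣ * ℕ→ℚ n
  e⁺-∁-≤ U =
    cut-upper-bound (ℕ→ℚ (∣ U ∣ ℕ.* ∣ ∁ U ∣)) (c * ℕ→ℚ ∣ U ∣ * ℕ→ℚ n) (ℕ→ℚ (e⁺ D U (∁ U))) (ℕ→ℚ (e⁻ D U (∁ U)))
      (ℕ→ℚ-e⁺+e⁻≤∣∣*∣∣ D U (∁ U) oriented) (e⁻-∁-≥ U)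

  e⁻-∁-≤ : (U : Subset n) →
    ℕ→ℚ (e⁻ D U (∁ U)) ≤ ℕ→ℚ (∣ U ∣ ℕ.* ∣ ∁ U ∣) * ½ + c * ℕ→ℚ ∣ U ∣ * ℕ→ℚ n
  e⁻-∁-≤ U =
    cut-upper-bound (ℕ→ℚ (∣ U ∣ ℕ.* ∣ ∁ U ∣)) (c * ℕ→ℚ ∣ U ∣ * ℕ→ℚ n) (ℕ→ℚ (e⁻ D U (∁ U))) (ℕ→ℚ (e⁺ D U (∁ U)))
      (subst (_≤ _) (+-comm (ℕ→ℚ (e⁺ D U (∁ U))) (ℕ→ℚ (e⁻ D U (∁ U)))) (ℕ→ℚ-e⁺+e⁻≤∣∣*∣∣ D U (∁ U) oriented))
      (e⁺-∁-≥ U)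

  e-≥ : (U : Subset n) → ℕ→ℚ ∣ U ∣ * (ℕ→ℚ ∣ U ∣ - + 2 / 1 * c * ℕ→ℚ n) * ½ ≤ ℕ→ℚ (e D U)
  e-≥ U =
    inside-lower-bound (ℕ→ℚ ∣ U ∣) (ℕ→ℚ ∣ ∁ U ∣) (ℕ→ℚ (e D U)) (ℕ→ℚ (e⁺ D U (∁ U))) (ℕ→ℚ (e⁻ D U (∁ U)))
                       c (ℕ→ℚ n) (ℕ→ℚ-∣p∣+∣∁p∣ U) (out-arcs-split-≥ U) in-arcs both-ways
    where
    in-arcs : ℕ→ℚ ∣ U ∣ * ((½ - c) * ℕ→ℚ n) ≤ ℕ→ℚ (e D U) + ℕ→ℚ (e⁻ D U (∁ U))
    in-arcs = subst₂ (λ x y → _ ≤ x + y) (cong ℕ→ℚ (sym (e⁺-transpose D U U)))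
                     (cong ℕ→ℚ (sym (e⁺-transpose D (∁ U) U))) (Dᵀ.out-arcs-split-≥ U)
    both-ways : ℕ→ℚ (e⁺ D U (∁ U)) + ℕ→ℚ (e⁻ D U (∁ U)) ≤ ℕ→ℚ ∣ U ∣ * ℕ→ℚ ∣ ∁ U ∣
    both-ways = subst (ℕ→ℚ (e⁺ D U (∁ U)) + ℕ→ℚ (e⁻ D U (∁ U)) ≤_) (ℕ→ℚ-* ∣ U ∣ ∣ ∁ U ∣)
                      (ℕ→ℚ-e⁺+e⁻≤∣∣*∣∣ D U (∁ U) oriented)

  e⁺-between-≥ : 0ℚ ≤ c → c ≤ + 1 / 100 → (S U : Subset n) →
    (½ - c) * ℕ→ℚ n ≤ ℕ→ℚ ∣ S ∣ → (½ - c) * ℕ→ℚ n ≤ ℕ→ℚ ∣ U ∣ →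
    ℕ→ℚ n * ℕ→ℚ n * (+ 1 / 41) ≤ ℕ→ℚ (e⁺ D S U)
  e⁺-between-≥ 0≤c c≤1/100 S U large-S large-U = begin
    N * N * (+ 1 / 41)
      ≤⟨ quarter-square-bound c N (x + s) 0≤c c≤1/100 (0≤ℕ→ℚ n) large-x+s ⟩
    (x + s) * (x + s) * (+ 1 / 4) - + 2 / 1 * c * N * (x + s)
      ≤⟨ halves-≥-quarter x s c N (0≤ℕ→ℚ ∣ S ∩ U ∣) 0≤c (0≤ℕ→ℚ n) ⟩
    x * (x - + 2 / 1 * c * N) * ½ + s * (s * ½ - + 2 / 1 * c * N)
      ≤⟨ +-mono-≤ (e-≥ (S ∩ U)) (e⁺-into-disjoint-≥ (S ∩ ∁ U) U S∖U-disjoint large-U) ⟩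
    ℕ→ℚ (e D (S ∩ U)) + ℕ→ℚ (e⁺ D (S ∩ ∁ U) U)
      ≡⟨ ℕ→ℚ-+ (e D (S ∩ U)) (e⁺ D (S ∩ ∁ U) U) ⟨
    ℕ→ℚ (e D (S ∩ U) ℕ.+ e⁺ D (S ∩ ∁ U) U)
      ≤⟨ ℕ→ℚ-mono-≤ split ⟩
    ℕ→ℚ (e⁺ D S U)
      ∎
    where
    open ≤-Reasoning
    N x s : ℚ
    N = ℕ→ℚ n
    x = ℕ→ℚ ∣ S ∩ U ∣
    s = ℕ→ℚ ∣ S ∩ ∁ U ∣
    large-x+s : (½ - c) * N ≤ x + s
    large-x+s = subst ((½ - c) * N ≤_) (ℕ→ℚ-∣∣-⊎ (∩-split S U)) large-S
    S∖U-disjoint : ∀ i → lookup (S ∩ ∁ U) i ∧ lookup U i ≡ false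
    S∖U-disjoint i rewrite lookup-∩∁ S U i with lookup S i | lookup U i
    ... | false | _     = refl
    ... | true  | true  = refl
    ... | true  | false = refl
    S∩U⊆U : ∀ i → χ (S ∩ U) i ℕ.≤ χ U i
    S∩U⊆U i rewrite lookup-∩ S U i with lookup S i
    ... | true  = ℕ.≤-refl
    ... | false = ℕ.z≤n
    split : e D (S ∩ U) ℕ.+ e⁺ D (S ∩ ∁ U) U ℕ.≤ e⁺ D S U
    split = ℕ.≤-trans (ℕ.+-monoˡ-≤ (e⁺ D (S ∩ ∁ U) U) (e⁺-monoʳ {V = S ∩ U} {W = U} {D = D} {U = S ∩ U} S∩U⊆U))
                      (ℕ.≤-reflexive (sym (e⁺-⊎ˡ {D = D} {W = U} (∩-split S U))))

1/2200≤1/100 : + 1 / 2200 ≤ + 1 / 100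
1/2200≤1/100 = toWitness {a? = + 1 / 2200 ≤? + 1 / 100} _

lemma3p5 : (c : ℚ) → 0ℚ < c → c < + 1 / 2200 →
  (n : ℕ) (D : Digraph n) → IsOriented D →
  ((v : Fin n) → ((½ - c) * ℕ→ℚ n ≤ ℕ→ℚ (outdeg D v)) × ((½ - c) * ℕ→ℚ n ≤ ℕ→ℚ (indeg D v))) →
  (U : Subset n) →
    (((ℕ→ℚ (∣ U ∣ Data.Nat.* ∣ ∁ U ∣) * ½ - c * ℕ→ℚ ∣ U ∣ * ℕ→ℚ n ≤ ℕ→ℚ (e⁺ D U (∁ U)))
      × (ℕ→ℚ (e⁺ D U (∁ U)) ≤ ℕ→ℚ (∣ U ∣ Data.Nat.* ∣ ∁ U ∣) * ½ + c * ℕ→ℚ ∣ U ∣ * ℕ→ℚ n))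
    × ((ℕ→ℚ (∣ U ∣ Data.Nat.* ∣ ∁ U ∣) * ½ - c * ℕ→ℚ ∣ U ∣ * ℕ→ℚ n ≤ ℕ→ℚ (e⁻ D U (∁ U)))
      × (ℕ→ℚ (e⁻ D U (∁ U)) ≤ ℕ→ℚ (∣ U ∣ Data.Nat.* ∣ ∁ U ∣) * ½ + c * ℕ→ℚ ∣ U ∣ * ℕ→ℚ n)))
    × (ℕ→ℚ ∣ U ∣ * (ℕ→ℚ ∣ U ∣ - + 2 / 1 * c * ℕ→ℚ n) * ½ ≤ ℕ→ℚ (e D U))
    × ((S : Subset n) → (½ - c) * ℕ→ℚ n ≤ ℕ→ℚ ∣ S ∣ → (½ - c) * ℕ→ℚ n ≤ ℕ→ℚ ∣ U ∣ →
        ℕ→ℚ n * ℕ→ℚ n * (+ 1 / 41) ≤ ℕ→ℚ (e⁺ D S U))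
lemma3p5 c 0<c c<1/2200 n D oriented semidegree U =
    ( (e⁺-∁-≥ U , e⁺-∁-≤ U)
    , (e⁻-∁-≥ U , e⁻-∁-≤ U))
  , e-≥ U
  , λ S → e⁺-between-≥ (<⇒≤ 0<c) (<⇒≤ (<-≤-trans c<1/2200 1/2200≤1/100)) S U
  where
  open SemidegreeBounds D c oriented (proj₁ ∘ semidegree) (proj₂ ∘ semidegree)
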